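{- Let $M$ be a position and let $e \in \mathbf{N}$ have the same parity as $\Sigma(M)$. Let $w, w'$ be two entries of $M$ (at distinct indices) with $w \ge w'$. Let $M^+$ and $M^-$ be the positions obtained from $M$ by replacing the two entries $w, w'$ with a single entry $w+w'$, respectively $w-w'$. Then \[ \delta_e(M) = \delta_e(M^+) + (-1)^{w'} \delta_e(M^-). \]
   Context: A position is a finite multiset of non-negative integers, regarded as an indexed family $(m_i)_{i \in I}$; a subposition $N$ of $M$ is a sub-multiset, i.e. the subfamily indexed by a subset of $I$ (distinct index subsets give distinct subpositions), and $\bar N$ is its complement in $M$. For a position $N$, $\Sigma(N)$ denotes the sum of its elements. Set $\epsilon_M(N) = \Sigma(\bar N) - \Sigma(N)$. For $e \in \mathbf{N}$ with $e \equiv \Sigma(M) \pmod 2$, define \[ \delta_e(M) = \sum_{N} (-1)^{\Sigma(N)}, \] the sum over all subpositions $N$ of $M$ with $\epsilon_M(N) \ge e$. -}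

module Defs where

open import Data.Nat using (ℕ; zero; suc; _+_; _∸_; _≤_)
open import Data.Integer as ℤ using (ℤ; +_; -_)
open import Data.List using (List; []; _∷_; map; _++_; foldr; length)
open import Data.Nat.ListAction using (sum)
open import Data.Product using (_×_; _,_; proj₁; proj₂)
open import Data.Bool using (Bool; true; false; if_then_else_)
open import Data.Nat using (_≤ᵇ_)
open import Data.Nat.Base using (_%_)
open import Data.Fin using (Fin; zero; suc)
import Relation.Nullary
import Data.Nat

-- A position is a finite multiset of naturals, represented as a list
-- (an indexed family; indices = list positions).
Position : Set
Position = List ℕ

Σ : Position → ℕ
Σ = sum

-- All subpositions of M, each paired with its complement (N , N̄).
-- One entry per subset of the index set (so equal values at distinct
-- indices give distinct subpositions).
subpositions : Position → List (Position × Position)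
subpositions [] = ([] , []) ∷ []
subpositions (m ∷ ms) =
  map (λ p → (m ∷ proj₁ p , proj₂ p)) (subpositions ms)
  ++ map (λ p → (proj₁ p , m ∷ proj₂ p)) (subpositions ms)

sgn : ℕ → ℤ
sgn n = if (n % 2 Data.Nat.≡ᵇ 0) then + 1 else - (+ 1)

ε : Position × Position → ℤ
ε (N , N̄) = (+ Σ N̄) ℤ.- (+ Σ N)

δ : ℕ → Position → ℤ
δ e M = foldr (λ p acc → term p ℤ.+ acc) (+ 0) (subpositions M)
  where
    term : Position × Position → ℤ
    term p with (+ e) ℤ.≤? ε p
    ... | Relation.Nullary.yes _ = sgn (Σ (proj₁ p))
    ... | Relation.Nullary.no  _ = + 0

removeAt : (M : Position) → Fin (length M) → Position
removeAt (m ∷ ms) zero = ms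
removeAt (m ∷ ms) (suc i) = m ∷ removeAt ms i

-- remove the entries at indices i and j (meaningful when i ≢ j)
removeTwo : (M : Position) → Fin (length M) → Fin (length M) → Position
removeTwo [] () _
removeTwo (m ∷ ms) zero zero = ms
removeTwo (m ∷ ms) zero (suc j) = removeAt ms j
removeTwo (m ∷ ms) (suc i) zero = removeAt ms i
removeTwo (m ∷ ms) (suc i) (suc j) = m ∷ removeTwo ms i j

-- Generalise δ to an arbitrary integer threshold t: Δ t M = Σ over N with ε_M(N) ≥ t of
-- (-1)^Σ(N). Splitting on whether an entry m lies in N or in N̄ gives the recursion
-- Δ t (m ∷ M) = (-1)^m Δ (t + m) M + Δ (t - m) M, which we take as the definition of Δ.
-- It makes Δ t invariant under permutations, so w and w' may be moved to the front.
-- Expanding both yields four terms: the two in which w and w' lie on the same side of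
-- the split make up Δ t (M⁺), the two in which they are separated make up
-- (-1)^w' Δ t (M⁻), using (-1)^w = (-1)^w' (-1)^(w-w').
module Submission where

open import Defs
open import Data.Nat using (ℕ; _+_; _∸_; _≤_; _%_)
open import Data.Integer as ℤ using (ℤ)
open import Data.List using (List; _∷_; length; lookup)
open import Data.Fin using (Fin)
open import Relation.Binary.PropositionalEquality using (_≡_; _≢_)

open import Data.Nat using (zero; suc)
open import Data.Integer using (+_; -_; 0ℤ; 1ℤ)
import Data.Nat.Properties as ℕ
import Data.Integer.Properties as ℤ
open import Data.Integer.Tactic.RingSolver using (solve-∀)
open import Data.List using ([]; map; _++_; foldr)
open import Data.List.Properties using (foldr-map; foldr-cong)
open import Data.List.Relation.Binary.Permutation.Propositional
  using (_↭_; refl; prep; swap; trans; ↭-refl; ↭-prep; ↭-swap; ↭-trans)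
open import Data.Product using (_×_; _,_)
open import Data.Fin using (zero; suc)
open import Data.Empty using (⊥-elim)
open import Function using (_∘_)
open import Relation.Nullary using (yes; no)
open import Relation.Binary.PropositionalEquality
  using (refl; sym; cong; cong₂; subst₂; module ≡-Reasoning)
  renaming (trans to ≡-trans)

sgn-suc : ∀ n → sgn (suc n) ≡ - sgn n
sgn-suc zero = refl
sgn-suc (suc zero) = refl
sgn-suc (suc (suc n)) = sgn-suc n

sgn-+ : ∀ m n → sgn (m + n) ≡ sgn m ℤ.* sgn n
sgn-+ zero n = sym (ℤ.*-identityˡ (sgn n))
sgn-+ (suc m) n = begin
  sgn (suc (m + n))     ≡⟨ sgn-suc (m + n) ⟩
  - sgn (m + n)         ≡⟨ cong -_ (sgn-+ m n) ⟩
  - (sgn m ℤ.* sgn n)   ≡⟨ ℤ.neg-distribˡ-* (sgn m) (sgn n) ⟩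
  - sgn m ℤ.* sgn n     ≡⟨ cong (ℤ._* sgn n) (sym (sgn-suc m)) ⟩
  sgn (suc m) ℤ.* sgn n ∎
  where open ≡-Reasoning

gated : ℤ → ℤ → ℤ → ℤ
gated t x v with t ℤ.≤? x
... | yes _ = v
... | no  _ = 0ℤ

+-cancelʳ-≤ : ∀ c {t x} → t ℤ.+ c ℤ.≤ x ℤ.+ c → t ℤ.≤ x
+-cancelʳ-≤ c {t} {x} p = subst₂ ℤ._≤_ (cancel t c) (cancel x c) (ℤ.+-monoˡ-≤ (- c) p)
  where
  cancel : ∀ y c → y ℤ.+ c ℤ.+ - c ≡ y
  cancel = solve-∀

gated-shift : ∀ c t x v → gated t x v ≡ gated (t ℤ.+ c) (x ℤ.+ c) v
gated-shift c t x v with t ℤ.≤? x | t ℤ.+ c ℤ.≤? x ℤ.+ c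
... | yes _   | yes _    = refl
... | no  _   | no  _    = refl
... | yes t≤x | no  t≰x  = ⊥-elim (t≰x (ℤ.+-monoˡ-≤ c t≤x))
... | no  t≰x | yes t≤x  = ⊥-elim (t≰x (+-cancelʳ-≤ c t≤x))

*-gated : ∀ c t x v → c ℤ.* gated t x v ≡ gated t x (c ℤ.* v)
*-gated c t x v with t ℤ.≤? x
... | yes _ = refl
... | no  _ = ℤ.*-zeroʳ c

ε-∷ˡ : ∀ m N N̄ → ε (m ∷ N , N̄) ℤ.+ + m ≡ ε (N , N̄)
ε-∷ˡ m N N̄ = begin
  + Σ N̄ ℤ.- + (m + Σ N) ℤ.+ + m       ≡⟨ cong (λ z → + Σ N̄ ℤ.- z ℤ.+ + m) (ℤ.pos-+ m (Σ N)) ⟩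
  + Σ N̄ ℤ.- (+ m ℤ.+ + Σ N) ℤ.+ + m   ≡⟨ cancel (+ Σ N̄) (+ m) (+ Σ N) ⟩
  + Σ N̄ ℤ.- + Σ N                     ∎
  where
  open ≡-Reasoning
  cancel : ∀ a b c → a ℤ.- (b ℤ.+ c) ℤ.+ b ≡ a ℤ.- c
  cancel = solve-∀

ε-∷ʳ : ∀ m N N̄ → ε (N , m ∷ N̄) ℤ.- + m ≡ ε (N , N̄)
ε-∷ʳ m N N̄ = begin
  + (m + Σ N̄) ℤ.- + Σ N ℤ.- + m       ≡⟨ cong (λ z → z ℤ.- + Σ N ℤ.- + m) (ℤ.pos-+ m (Σ N̄)) ⟩
  (+ m ℤ.+ + Σ N̄) ℤ.- + Σ N ℤ.- + m   ≡⟨ cancel (+ Σ N̄) (+ m) (+ Σ N) ⟩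
  + Σ N̄ ℤ.- + Σ N                     ∎
  where
  open ≡-Reasoning
  cancel : ∀ a b c → b ℤ.+ a ℤ.- c ℤ.- b ≡ a ℤ.- c
  cancel = solve-∀

∑ : {A : Set} → (A → ℤ) → List A → ℤ
∑ f = foldr (λ x acc → f x ℤ.+ acc) 0ℤ

∑-++ : {A : Set} (f : A → ℤ) (xs ys : List A) → ∑ f (xs ++ ys) ≡ ∑ f xs ℤ.+ ∑ f ys
∑-++ f [] ys = sym (ℤ.+-identityˡ (∑ f ys))
∑-++ f (x ∷ xs) ys = begin
  f x ℤ.+ ∑ f (xs ++ ys)           ≡⟨ cong (λ z → f x ℤ.+ z) (∑-++ f xs ys) ⟩
  f x ℤ.+ (∑ f xs ℤ.+ ∑ f ys)     ≡⟨ sym (ℤ.+-assoc (f x) (∑ f xs) (∑ f ys)) ⟩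
  f x ℤ.+ ∑ f xs ℤ.+ ∑ f ys       ∎
  where open ≡-Reasoning

∑-map : {A B : Set} (f : B → ℤ) (g : A → B) (xs : List A) → ∑ f (map g xs) ≡ ∑ (f ∘ g) xs
∑-map f g = foldr-map _ g 0ℤ

∑-cong : {A : Set} {f g : A → ℤ} → (∀ x → f x ≡ g x) → (xs : List A) → ∑ f xs ≡ ∑ g xs
∑-cong f≗g = foldr-cong (λ x acc → cong (ℤ._+ acc) (f≗g x)) refl

∑-*ˡ : {A : Set} (c : ℤ) (f : A → ℤ) (xs : List A) → ∑ (λ x → c ℤ.* f x) xs ≡ c ℤ.* ∑ f xs
∑-*ˡ c f [] = sym (ℤ.*-zeroʳ c)
∑-*ˡ c f (x ∷ xs) = ≡-trans (cong (λ z → c ℤ.* f x ℤ.+ z) (∑-*ˡ c f xs)) (sym (ℤ.*-distribˡ-+ c (f x) (∑ f xs)))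

contribution : ℤ → Position × Position → ℤ
contribution t (N , N̄) = gated t (ε (N , N̄)) (sgn (Σ N))

δ≡∑contribution : ∀ e M → δ e M ≡ ∑ (contribution (+ e)) (subpositions M)
δ≡∑contribution e M = ≡-trans unfold (foldr-cong step refl (subpositions M))
  where
  -- The summand of δ is local to its definition; unifying with δ's unfolding names it.
  summand : Position × Position → ℤ → ℤ
  summand = _
  unfold : δ e M ≡ foldr summand (+ 0) (subpositions M)
  unfold = refl

  step : ∀ p acc → summand p acc ≡ contribution (+ e) p ℤ.+ acc
  step (N , N̄) acc with + e ℤ.≤? ε (N , N̄)
  ... | yes _ = refl
  ... | no  _ = refl

contribution-∷ˡ : ∀ t m N N̄ →
  contribution t (m ∷ N , N̄) ≡ sgn m ℤ.* contribution (t ℤ.+ + m) (N , N̄)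
contribution-∷ˡ t m N N̄ = begin
  gated t (ε (m ∷ N , N̄)) (sgn (m + Σ N))
    ≡⟨ gated-shift (+ m) t _ _ ⟩
  gated (t ℤ.+ + m) (ε (m ∷ N , N̄) ℤ.+ + m) (sgn (m + Σ N))
    ≡⟨ cong₂ (gated (t ℤ.+ + m)) (ε-∷ˡ m N N̄) (sgn-+ m (Σ N)) ⟩
  gated (t ℤ.+ + m) (ε (N , N̄)) (sgn m ℤ.* sgn (Σ N))
    ≡⟨ sym (*-gated (sgn m) _ _ _) ⟩
  sgn m ℤ.* contribution (t ℤ.+ + m) (N , N̄) ∎
  where open ≡-Reasoning

contribution-∷ʳ : ∀ t m N N̄ → contribution t (N , m ∷ N̄) ≡ contribution (t ℤ.- + m) (N , N̄)
contribution-∷ʳ t m N N̄ =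
  ≡-trans (gated-shift (- + m) t _ _) (cong (λ x → gated (t ℤ.- + m) x _) (ε-∷ʳ m N N̄))

Δ : ℤ → Position → ℤ
Δ t [] = gated t 0ℤ 1ℤ
Δ t (m ∷ M) = sgn m ℤ.* Δ (t ℤ.+ + m) M ℤ.+ Δ (t ℤ.- + m) M

∑contribution≡Δ : ∀ t M → ∑ (contribution t) (subpositions M) ≡ Δ t M
∑contribution≡Δ t [] = ℤ.+-identityʳ (Δ t [])
∑contribution≡Δ t (m ∷ M) = begin
  ∑ (contribution t) (map withM ps ++ map withoutM ps)
    ≡⟨ ∑-++ (contribution t) (map withM ps) (map withoutM ps) ⟩
  ∑ (contribution t) (map withM ps) ℤ.+ ∑ (contribution t) (map withoutM ps)
    ≡⟨ cong₂ ℤ._+_ (∑-map (contribution t) withM ps) (∑-map (contribution t) withoutM ps) ⟩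
  ∑ (contribution t ∘ withM) ps ℤ.+ ∑ (contribution t ∘ withoutM) ps
    ≡⟨ cong₂ ℤ._+_ (∑-cong (λ (N , N̄) → contribution-∷ˡ t m N N̄) ps)
                   (∑-cong (λ (N , N̄) → contribution-∷ʳ t m N N̄) ps) ⟩
  ∑ (λ p → sgn m ℤ.* contribution (t ℤ.+ + m) p) ps ℤ.+ ∑ (contribution (t ℤ.- + m)) ps
    ≡⟨ cong (ℤ._+ ∑ (contribution (t ℤ.- + m)) ps) (∑-*ˡ (sgn m) (contribution (t ℤ.+ + m)) ps) ⟩
  sgn m ℤ.* ∑ (contribution (t ℤ.+ + m)) ps ℤ.+ ∑ (contribution (t ℤ.- + m)) ps
    ≡⟨ cong₂ (λ a b → sgn m ℤ.* a ℤ.+ b) (∑contribution≡Δ (t ℤ.+ + m) M) (∑contribution≡Δ (t ℤ.- + m) M) ⟩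
  Δ t (m ∷ M) ∎
  where
  open ≡-Reasoning
  ps = subpositions M
  withM withoutM : Position × Position → Position × Position
  withM (N , N̄) = (m ∷ N , N̄)
  withoutM (N , N̄) = (N , m ∷ N̄)

Δ-∷-cong : ∀ m R R' → (∀ t → Δ t R ≡ Δ t R') → ∀ t → Δ t (m ∷ R) ≡ Δ t (m ∷ R')
Δ-∷-cong m R R' R≈R' t = cong₂ (λ a b → sgn m ℤ.* a ℤ.+ b) (R≈R' (t ℤ.+ + m)) (R≈R' (t ℤ.- + m))

Δ-swap : ∀ t x y R → Δ t (x ∷ y ∷ R) ≡ Δ t (y ∷ x ∷ R)
Δ-swap t x y R = begin
  sgn x ℤ.* (sgn y ℤ.* Δ (t ℤ.+ X ℤ.+ Y) R ℤ.+ Δ (t ℤ.+ X ℤ.- Y) R)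
    ℤ.+ (sgn y ℤ.* Δ (t ℤ.- X ℤ.+ Y) R ℤ.+ Δ (t ℤ.- X ℤ.- Y) R)
      ≡⟨ rearrange (sgn x) (sgn y) _ _ _ _ ⟩
  sgn y ℤ.* (sgn x ℤ.* Δ (t ℤ.+ X ℤ.+ Y) R ℤ.+ Δ (t ℤ.- X ℤ.+ Y) R)
    ℤ.+ (sgn x ℤ.* Δ (t ℤ.+ X ℤ.- Y) R ℤ.+ Δ (t ℤ.- X ℤ.- Y) R)
      ≡⟨ cong₂ ℤ._+_
           (cong (sgn y ℤ.*_) (cong₂ ℤ._+_ (cong (sgn x ℤ.*_) (exchange X Y)) (exchange (- X) Y)))
           (cong₂ ℤ._+_ (cong (sgn x ℤ.*_) (exchange X (- Y))) (exchange (- X) (- Y))) ⟩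
  sgn y ℤ.* (sgn x ℤ.* Δ (t ℤ.+ Y ℤ.+ X) R ℤ.+ Δ (t ℤ.+ Y ℤ.- X) R)
    ℤ.+ (sgn x ℤ.* Δ (t ℤ.- Y ℤ.+ X) R ℤ.+ Δ (t ℤ.- Y ℤ.- X) R) ∎
  where
  open ≡-Reasoning
  X = + x
  Y = + y
  rearrange : ∀ p q a b c d → p ℤ.* (q ℤ.* a ℤ.+ b) ℤ.+ (q ℤ.* c ℤ.+ d)
                            ≡ q ℤ.* (p ℤ.* a ℤ.+ c) ℤ.+ (p ℤ.* b ℤ.+ d)
  rearrange = solve-∀
  exchange : ∀ a b → Δ (t ℤ.+ a ℤ.+ b) R ≡ Δ (t ℤ.+ b ℤ.+ a) R
  exchange a b = cong (λ u → Δ u R) (right-comm t a b)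
    where
    right-comm : ∀ u a b → u ℤ.+ a ℤ.+ b ≡ u ℤ.+ b ℤ.+ a
    right-comm = solve-∀

Δ-↭ : ∀ {R R'} → R ↭ R' → ∀ t → Δ t R ≡ Δ t R'
Δ-↭ refl t = refl
Δ-↭ (prep {xs = R} {ys = R'} m R↭R') t = Δ-∷-cong m R R' (Δ-↭ R↭R') t
Δ-↭ (swap {xs = R} {ys = R'} x y R↭R') t =
  ≡-trans (Δ-swap t x y R) (Δ-∷-cong y (x ∷ R) (x ∷ R') (Δ-∷-cong x R R' (Δ-↭ R↭R')) t)
Δ-↭ (trans R↭R' R'↭R'') t = ≡-trans (Δ-↭ R↭R' t) (Δ-↭ R'↭R'' t)

↭-removeAt : ∀ M i → M ↭ lookup M i ∷ removeAt M i
↭-removeAt (m ∷ M) zero = ↭-refl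
↭-removeAt (m ∷ M) (suc i) = ↭-trans (↭-prep m (↭-removeAt M i)) (↭-swap m (lookup M i) ↭-refl)

↭-removeTwo : ∀ M i j → i ≢ j → M ↭ lookup M i ∷ lookup M j ∷ removeTwo M i j
↭-removeTwo (m ∷ M) zero    zero    i≢j = ⊥-elim (i≢j refl)
↭-removeTwo (m ∷ M) zero    (suc j) _   = ↭-prep m (↭-removeAt M j)
↭-removeTwo (m ∷ M) (suc i) zero    _   = ↭-removeAt (m ∷ M) (suc i)
↭-removeTwo (m ∷ M) (suc i) (suc j) i≢j =
  ↭-trans (↭-prep m (↭-removeTwo M i j (i≢j ∘ cong suc)))
  (↭-trans (↭-swap m (lookup M i) ↭-refl) (↭-prep (lookup M i) (↭-swap m (lookup M j) ↭-refl)))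

Δ-merge : ∀ t {w w'} R → w' ≤ w →
  Δ t (w ∷ w' ∷ R) ≡ Δ t ((w + w') ∷ R) ℤ.+ sgn w' ℤ.* Δ t ((w ∸ w') ∷ R)
Δ-merge t {w} {w'} R w'≤w = begin
  sgn w ℤ.* (p ℤ.* Δ (t ℤ.+ W ℤ.+ W') R ℤ.+ Δ (t ℤ.+ W ℤ.- W') R)
    ℤ.+ (p ℤ.* Δ (t ℤ.- W ℤ.+ W') R ℤ.+ Δ (t ℤ.- W ℤ.- W') R)
      ≡⟨ cong₂ (λ s u → s ℤ.* (p ℤ.* Δ u R ℤ.+ Δ (t ℤ.+ W ℤ.- W') R)
                          ℤ.+ (p ℤ.* Δ (t ℤ.- W ℤ.+ W') R ℤ.+ Δ (t ℤ.- W ℤ.- W') R))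
               sgn-w (ℤ.+-assoc t W W') ⟩
  p ℤ.* q ℤ.* (p ℤ.* Δ (t ℤ.+ (W ℤ.+ W')) R ℤ.+ Δ (t ℤ.+ W ℤ.- W') R)
    ℤ.+ (p ℤ.* Δ (t ℤ.- W ℤ.+ W') R ℤ.+ Δ (t ℤ.- W ℤ.- W') R)
      ≡⟨ rearrange p q _ _ _ _ ⟩
  p ℤ.* q ℤ.* p ℤ.* Δ (t ℤ.+ (W ℤ.+ W')) R ℤ.+ Δ (t ℤ.- W ℤ.- W') R
    ℤ.+ p ℤ.* (q ℤ.* Δ (t ℤ.+ W ℤ.- W') R ℤ.+ Δ (t ℤ.- W ℤ.+ W') R)
      ≡⟨ cong₂ ℤ._+_
           (cong₂ ℤ._+_ (cong₂ ℤ._*_ (sym sgn-w+w') (cong (λ u → Δ (t ℤ.+ u) R) (sym (ℤ.pos-+ w w'))))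
                        (cong (λ u → Δ u R) (≡-trans (sub-sub t W W') (cong (λ u → t ℤ.- u) (sym (ℤ.pos-+ w w'))))))
           (cong (p ℤ.*_) (cong₂ ℤ._+_
             (cong (λ u → q ℤ.* Δ u R) (≡-trans (ℤ.+-assoc t W (- W')) (cong (λ u → t ℤ.+ u) (sym d≡W-W'))))
             (cong (λ u → Δ u R) (≡-trans (sub-add t W W') (cong (λ u → t ℤ.- u) (sym d≡W-W')))))) ⟩
  sgn (w + w') ℤ.* Δ (t ℤ.+ + (w + w')) R ℤ.+ Δ (t ℤ.- + (w + w')) R
    ℤ.+ p ℤ.* (q ℤ.* Δ (t ℤ.+ + d) R ℤ.+ Δ (t ℤ.- + d) R) ∎
  where
  open ≡-Reasoning
  W = + w
  W' = + w'
  d = w ∸ w'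
  p = sgn w'
  q = sgn d
  sgn-w : sgn w ≡ p ℤ.* q
  sgn-w = ≡-trans (cong sgn (sym (ℕ.m+[n∸m]≡n w'≤w))) (sgn-+ w' d)
  sgn-w+w' : sgn (w + w') ≡ p ℤ.* q ℤ.* p
  sgn-w+w' = ≡-trans (sgn-+ w w') (cong (ℤ._* p) sgn-w)
  d≡W-W' : + d ≡ W ℤ.- W'
  d≡W-W' = sym (≡-trans (ℤ.m-n≡m⊖n w w') (ℤ.⊖-≥ w'≤w))
  rearrange : ∀ p q a b c e → p ℤ.* q ℤ.* (p ℤ.* a ℤ.+ b) ℤ.+ (p ℤ.* c ℤ.+ e)
                            ≡ p ℤ.* q ℤ.* p ℤ.* a ℤ.+ e ℤ.+ p ℤ.* (q ℤ.* b ℤ.+ c)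
  rearrange = solve-∀
  sub-sub : ∀ t a b → t ℤ.- a ℤ.- b ≡ t ℤ.- (a ℤ.+ b)
  sub-sub = solve-∀
  sub-add : ∀ t a b → t ℤ.- a ℤ.+ b ≡ t ℤ.- (a ℤ.- b)
  sub-add = solve-∀

lemma3 : (M : Position) (e : ℕ) → e % 2 ≡ Σ M % 2 →
    (i j : Fin (length M)) → i ≢ j → lookup M j ≤ lookup M i →
    δ e M ≡ δ e ((lookup M i + lookup M j) ∷ removeTwo M i j)
            ℤ.+ sgn (lookup M j) ℤ.* δ e ((lookup M i ∸ lookup M j) ∷ removeTwo M i j)
lemma3 M e _ i j i≢j w'≤w = begin
  δ e M                                         ≡⟨ δ≡Δ M ⟩
  Δ E M                                         ≡⟨ Δ-↭ (↭-removeTwo M i j i≢j) E ⟩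
  Δ E (w ∷ w' ∷ R)                              ≡⟨ Δ-merge E R w'≤w ⟩
  Δ E ((w + w') ∷ R) ℤ.+ sgn w' ℤ.* Δ E ((w ∸ w') ∷ R)
    ≡⟨ sym (cong₂ (λ a b → a ℤ.+ sgn w' ℤ.* b) (δ≡Δ ((w + w') ∷ R)) (δ≡Δ ((w ∸ w') ∷ R))) ⟩
  δ e ((w + w') ∷ R) ℤ.+ sgn w' ℤ.* δ e ((w ∸ w') ∷ R) ∎
  where
  open ≡-Reasoning
  E = + e
  w = lookup M i
  w' = lookup M j
  R = removeTwo M i j
  δ≡Δ : ∀ N → δ e N ≡ Δ E N
  δ≡Δ N = ≡-trans (δ≡∑contribution e N) (∑contribution≡Δ E N)
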